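{- Let $\Gamma=(H,\sigma)$ be a signed hypergraph with $H=(V,E)$, let $f:V\to\mathbb{R}$ be a non-zero function, and let $D_1,\dots,D_q$ be the weak nodal domains of $f$ (viewed as vertex sets). Let $H_D$ be the graph with vertex set $\{D_1,\dots,D_q\}$ in which $D_i$ and $D_j$ are joined whenever $D_i\sim D_j$, i.e. there exist $x\in D_i$, $y\in D_j$ and an edge $e\in E$ with $x,y\in e$. If $H$ is connected, then $H_D$ is connected.
   Context: A signed hypergraph $\Gamma=(H,\sigma)$: finite hypergraph $H=(V,E)$ with signs $\sigma(v,e)\in\{\pm1\}$ on incidences $v\in e$; $\mathrm{sgn}(e)=(-1)^{|e|-1}\prod_{v\in e}\sigma(v,e)$. $H$ is connected if any two vertices are joined by a path $v_1,e_1,\dots,e_q,v_{q+1}$ (distinct vertices, distinct edges, $v_r,v_{r+1}\in e_r$). For $f:V\to\mathbb{R}$ let $\Omega=\{f\ne0\}$. A W-path of $f$ is a vertex sequence $x_1,\dots,x_\ell$, consecutive vertices lying in common edges $e_t\ni x_t,x_{t+1}$, such that for any two consecutive nonzeros $x_i,x_j$ ($i<j$, $f(x_t)=0$ for $i<t<j$) one has $f(x_i)\mathrm{sgn}(e_i)\cdots\mathrm{sgn}(e_{j-1})f(x_j)>0$. On $\Omega$, $x R_W y$ iff $x=y$ or a W-path connects them; let $W_1,\dots,W_q$ be the equivalence classes. The weak nodal domains are (the induced subhypergraphs on) the sets $W_i^0=W_i\cup\{x\in V:$ there is a W-path from $x$ to some vertex of $W_i\}$.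
   Formalization: The function f takes values in ℚ instead of ℝ. -}

module Defs where

open import Data.Nat.Base using (ℕ; zero; suc; _∸_; _≤ᵇ_; _<ᵇ_)
open import Data.Fin.Base using (Fin; toℕ; inject₁; fromℕ; _<_)
open import Data.Fin.Subset using (Subset; _∈_; ∣_∣)
open import Data.Fin.Subset.Properties using (_∈?_)
open import Data.Sign.Base as S using (Sign; +; -)
open import Data.Rational using (ℚ; 0ℚ; 1ℚ) renaming (-_ to negℚ; _*_ to _*ℚ_; _<_ to _<ℚ_)
open import Data.Bool.Base using (Bool; true; false; if_then_else_; _∧_)
open import Data.List.Base using (List; foldr; allFin)
open import Data.Product using (Σ; ∃; _×_; _,_)
open import Data.Sum using (_⊎_)
open import Relation.Binary.PropositionalEquality using (_≡_; _≢_)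
open import Relation.Nullary.Decidable using (does)
open import Function.Definitions using (Injective)
open import Relation.Binary.Construct.Closure.ReflexiveTransitive using (Star)

-- Each hyperedge is a subset of the vertices; the hyperedges are pairwise
-- distinct (E is a set of subsets).  σ v e is the sign of the incidence
-- (v,e); its value for v ∉ e is irrelevant and never used.

record SignedHypergraph (n m : ℕ) : Set where
  field
    edge     : Fin m → Subset n
    distinct : Injective _≡_ _≡_ edge
    σ        : Fin n → Fin m → Sign

signPow : ℕ → Sign
signPow zero    = +
signPow (suc k) = S.opposite (signPow k)

signToℚ : Sign → ℚ
signToℚ + = 1ℚ
signToℚ - = negℚ 1ℚ

module _ {n m : ℕ} (Γ : SignedHypergraph n m) where
  open SignedHypergraph Γ

  -- sgn(e) = (-1)^(|e|-1) ∏_{v ∈ e} σ(v,e)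
  sgn : Fin m → Sign
  sgn e = signPow (∣ edge e ∣ ∸ 1)
          S.* foldr (λ v acc → (if does (v ∈? edge e) then σ v e else +) S.* acc)
                    + (allFin n)

  record Walk : Set where
    field
      len : ℕ
      xs  : Fin (suc len) → Fin n
      es  : Fin len → Fin m
      inc : ∀ t → (xs (inject₁ t) ∈ edge (es t)) × (xs (Fin.suc t) ∈ edge (es t))
    start : Fin n
    start = xs Fin.zero
    end : Fin n
    end = xs (fromℕ len)

  IsPath : Walk → Set
  IsPath w = Injective _≡_ _≡_ (Walk.xs w) × Injective _≡_ _≡_ (Walk.es w)

  Connected : Set
  Connected = ∀ x y → Σ Walk λ w → IsPath w × Walk.start w ≡ x × Walk.end w ≡ y

  module _ (f : Fin n → ℚ) where

    sgnBetween : (w : Walk) → Fin (suc (Walk.len w)) → Fin (suc (Walk.len w)) → Sign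
    sgnBetween w i j =
      foldr (λ t acc → (if (toℕ i ≤ᵇ toℕ t) ∧ (toℕ t <ᵇ toℕ j)
                        then sgn (Walk.es w t) else +) S.* acc)
            + (allFin (Walk.len w))

    IsWPath : Walk → Set
    IsWPath w = ∀ (i j : Fin (suc (Walk.len w))) → i < j
      → f (Walk.xs w i) ≢ 0ℚ → f (Walk.xs w j) ≢ 0ℚ
      → (∀ t → i < t → t < j → f (Walk.xs w t) ≡ 0ℚ)
      → 0ℚ <ℚ (f (Walk.xs w i) *ℚ signToℚ (sgnBetween w i j)) *ℚ f (Walk.xs w j)

    WPath : Fin n → Fin n → Set
    WPath x y = Σ Walk λ w → IsWPath w × Walk.start w ≡ x × Walk.end w ≡ y

    Ω : Fin n → Set
    Ω x = f x ≢ 0ℚ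

    R_W : Fin n → Fin n → Set
    R_W x y = Ω x × Ω y × (x ≡ y ⊎ WPath x y)

    -- Every weak nodal domain is of the form WeakNodalDomain a for some a ∈ Ω.
    WeakNodalDomain : Fin n → (Fin n → Set)
    WeakNodalDomain a x = R_W x a ⊎ ∃ λ y → R_W y a × WPath x y

    _∼_ : (Fin n → Set) → (Fin n → Set) → Set
    D ∼ D' = ∃ λ x → ∃ λ y → ∃ λ e → D x × D' y × x ∈ edge e × y ∈ edge e

    -- adjacency in H_D, vertices of H_D given by representatives a ∈ Ω
    AdjD : Fin n → Fin n → Set
    AdjD a b = Ω a × Ω b × (WeakNodalDomain a ∼ WeakNodalDomain b)

    H_D-Connected : Set
    H_D-Connected = ∀ a b → Ω a → Ω b → Star AdjD a b

{-# OPTIONS --safe #-}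
module Submission where

open import Defs
open import Data.Nat.Base using (ℕ; zero; suc; z≤n; s≤s)
open import Data.Fin.Base using (Fin; fromℕ; inject₁; _<_)
open import Data.Fin.Subset using (_∈_)
open import Data.Rational using (ℚ; 0ℚ; _≟_)
open import Data.Product using (Σ; ∃; _×_; _,_)
open import Data.Sum using (inj₁; inj₂)
open import Data.Empty using (⊥-elim)
open import Function.Base using (_∘_)
open import Relation.Binary.PropositionalEquality using (_≡_; refl)
open import Relation.Nullary using (¬_; yes; no)
open import Relation.Binary.Construct.Closure.ReflexiveTransitive using (Star; ε; _◅_)

-- Walk along a path of H from a to b, remembering the last nonzero vertex c
-- passed. The zeros visited since then form a walk back to c with only one
-- nonzero vertex, which is vacuously a W-path, so they lie in the weak nodal
-- domain of c. When the walk reaches the next nonzero vertex y, the edge just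
-- used therefore joins the domains of c and y in H_D.

module _ {n m : ℕ} (Γ : SignedHypergraph n m) where
  open SignedHypergraph Γ
  open Walk

  Adjacent : Fin n → Fin n → Set
  Adjacent x y = ∃ λ e → x ∈ edge e × y ∈ edge e

  adjacent-sym : ∀ {x y} → Adjacent x y → Adjacent y x
  adjacent-sym (e , x∈e , y∈e) = e , y∈e , x∈e

  walk⇒star : (w : Walk Γ) → Star Adjacent (start w) (end w)
  walk⇒star w = steps⇒star (len w) (xs w) (λ t → es w t , inc w t)
    where
    steps⇒star : ∀ l (xs : Fin (suc l) → Fin n)
               → (∀ t → Adjacent (xs (inject₁ t)) (xs (Fin.suc t)))
               → Star Adjacent (xs Fin.zero) (xs (fromℕ l))
    steps⇒star zero    xs steps = ε
    steps⇒star (suc l) xs steps = steps Fin.zero ◅ steps⇒star l (xs ∘ Fin.suc) (steps ∘ Fin.suc)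

  trivialWalk : Fin n → Walk Γ
  trivialWalk a = record { len = 0 ; xs = λ _ → a ; es = λ () ; inc = λ () }

  cons : (y : Fin n) (w : Walk Γ) → Adjacent y (start w) → Walk Γ
  cons y w (e , y∈e , z∈e) = record
    { len = suc (len w)
    ; xs  = λ { Fin.zero → y ; (Fin.suc t) → xs w t }
    ; es  = λ { Fin.zero → e ; (Fin.suc t) → es w t }
    ; inc = λ { Fin.zero → y∈e , z∈e ; (Fin.suc t) → inc w t }
    }

  module _ (f : Fin n → ℚ) where

    VanishesBeforeEnd : Walk Γ → Set
    VanishesBeforeEnd w = ∀ (i j : Fin (suc (len w))) → i < j → f (xs w i) ≡ 0ℚ

    ZeroWalk : Fin n → Fin n → Set
    ZeroWalk z a = Σ (Walk Γ) λ w → VanishesBeforeEnd w × start w ≡ z × end w ≡ a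

    zeroWalk-refl : ∀ a → ZeroWalk a a
    zeroWalk-refl a = trivialWalk a , (λ { Fin.zero Fin.zero () ; Fin.zero (Fin.suc ()) }) , refl , refl

    zeroWalk-cons : ∀ {y z a} → f y ≡ 0ℚ → Adjacent y z → ZeroWalk z a → ZeroWalk y a
    zeroWalk-cons {y} fy≡0 y~z (w , vanishes , refl , end≡a) =
      cons y w y~z , vanishes′ , refl , end≡a
      where
      vanishes′ : VanishesBeforeEnd (cons y w y~z)
      vanishes′ Fin.zero    _           _         = fy≡0
      vanishes′ (Fin.suc i) (Fin.suc j) (s≤s i<j) = vanishes i j i<j

    zeroWalk-Ω⇒≡ : ∀ {z a} → Ω Γ f z → ZeroWalk z a → z ≡ a
    zeroWalk-Ω⇒≡ _  (record { len = zero } , _ , refl , refl) = refl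
    zeroWalk-Ω⇒≡ Ωz (record { len = suc l } , vanishes , refl , refl) =
      ⊥-elim (Ωz (vanishes Fin.zero (fromℕ (suc l)) (s≤s z≤n)))

    zeroWalk⇒wPath : ∀ {z a} → ZeroWalk z a → WPath Γ f z a
    zeroWalk⇒wPath (w , vanishes , start≡z , end≡a) =
      w , (λ i j i<j fi≢0 _ _ → ⊥-elim (fi≢0 (vanishes i j i<j))) , start≡z , end≡a

    zeroWalk⇒∈domain : ∀ {z a} → Ω Γ f a → ZeroWalk z a → WeakNodalDomain Γ f a z
    zeroWalk⇒∈domain Ωa zw = inj₂ (_ , (Ωa , Ωa , inj₁ refl) , zeroWalk⇒wPath zw)

    zeroWalk⇒domainsAdjacent : ∀ {a z y} → Ω Γ f a → Ω Γ f y → ZeroWalk z a → Adjacent z y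
                             → AdjD Γ f a y
    zeroWalk⇒domainsAdjacent {y = y} Ωa Ωy zw (e , z∈e , y∈e) =
      Ωa , Ωy , _ , y , e , zeroWalk⇒∈domain Ωa zw , zeroWalk⇒∈domain Ωy (zeroWalk-refl y) , z∈e , y∈e

    -- a plays the role of c above, z is the current vertex of the walk.
    star⇒domainStar : ∀ {a z b} → Ω Γ f a → ZeroWalk z a → Star Adjacent z b → Ω Γ f b
                    → Star (AdjD Γ f) a b
    star⇒domainStar Ωa zw ε Ωb with zeroWalk-Ω⇒≡ Ωb zw
    ... | refl = ε
    star⇒domainStar Ωa zw (_◅_ {j = y} z~y rest) Ωb with f y ≟ 0ℚ
    ... | yes fy≡0 = star⇒domainStar Ωa (zeroWalk-cons fy≡0 (adjacent-sym z~y) zw) rest Ωb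
    ... | no Ωy    = zeroWalk⇒domainsAdjacent Ωa Ωy zw z~y ◅ star⇒domainStar Ωy (zeroWalk-refl y) rest Ωb

-- The nonvanishing of f only guarantees that H_D has a vertex; H_D-Connected
-- quantifies over representatives in Ω.
proposition3p7 : ∀ {n m : ℕ} (Γ : SignedHypergraph n m) (f : Fin n → ℚ)
    → ¬ (∀ x → f x ≡ 0ℚ)
    → Connected Γ
    → H_D-Connected Γ f
proposition3p7 Γ f _ connected a b Ωa Ωb with connected a b
... | w , _ , refl , refl = star⇒domainStar Γ f Ωa (zeroWalk-refl Γ f a) (walk⇒star Γ w) Ωb
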